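{- Let $T$ be a tree and $c$ a coloring of $T$. Then there exists a $\gamma_{uc}$--dominating $c$--set $D$ of $(T,c)$ such that every leaf of $T$ belonging to $D$ is a local maximum for $c$.
   Context: A coloring of a graph $G=(V,E)$ is a map $c:V\to\{0,1,2,\dots\}$ with $c(u)\neq c(v)$ whenever $u,v$ are adjacent. Given $(G,c)$, a set $D\subseteq V$ is an up--color dominating $c$--set if (1) every vertex $v\notin D$ has a neighbor $d\in D$ with $c(v)<c(d)$, and (2) $D$ contains no vertex of color $0$. A $\gamma_{uc}$--dominating $c$--set is an up--color dominating $c$--set of minimum cardinality. A vertex $v$ is a local maximum for $c$ if $c(u)\leq c(v)$ for every neighbor $u$ of $v$. -}

module Defs where

open import Data.Nat using (ℕ; zero; suc; _≤_; _<_)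
open import Data.Bool using (Bool; true; false)
open import Data.Fin using (Fin)
open import Data.Fin.Subset using (Subset; _∈_; _∉_; ∣_∣)
open import Data.List using (List; []; _∷_; length; filterᵇ; allFin; last)
open import Data.List.Relation.Unary.Unique.Propositional using (Unique)
open import Data.Maybe using (just)
open import Data.Product using (Σ; ∃; _×_; _,_)
open import Data.Empty using (⊥)
open import Data.Unit using (⊤)
open import Relation.Nullary using (¬_)
open import Relation.Binary.PropositionalEquality using (_≡_; _≢_)

record Graph (n : ℕ) : Set where
  field
    adj    : Fin n → Fin n → Bool
    sym    : ∀ u v → adj u v ≡ adj v u
    irrefl : ∀ v → adj v v ≡ false

open Graph public

module _ {n : ℕ} (G : Graph n) where

  Adj : Fin n → Fin n → Set
  Adj u v = adj G u v ≡ true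

  Chain : List (Fin n) → Set
  Chain []           = ⊤
  Chain (x ∷ [])     = ⊤
  Chain (x ∷ y ∷ xs) = Adj x y × Chain (y ∷ xs)

  record Path (u v : Fin n) : Set where
    field
      verts  : List (Fin n)
      starts : Σ (List (Fin n)) (λ rest → verts ≡ u ∷ rest)
      ends   : last verts ≡ just v
      chain  : Chain verts
      unique : Unique verts

  Connected : Set
  Connected = ∀ u v → Path u v

  record Cycle : Set where
    field
      x₀ x₁ x₂ : Fin n
      rest     : List (Fin n)
      chain    : Chain (x₀ ∷ x₁ ∷ x₂ ∷ rest)
      closing  : Σ (Fin n) (λ y → last (x₀ ∷ x₁ ∷ x₂ ∷ rest) ≡ just y × Adj y x₀)
      unique   : Unique (x₀ ∷ x₁ ∷ x₂ ∷ rest)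

  Acyclic : Set
  Acyclic = ¬ Cycle

  IsTree : Set
  IsTree = Connected × Acyclic

  degree : Fin n → ℕ
  degree v = length (filterᵇ (adj G v) (allFin n))

  IsLeaf : Fin n → Set
  IsLeaf v = degree v ≡ 1

  IsColoring : (Fin n → ℕ) → Set
  IsColoring c = ∀ u v → Adj u v → c u ≢ c v

  module _ (c : Fin n → ℕ) where

    IsUpColorDom : Subset n → Set
    IsUpColorDom D =
      (∀ v → v ∉ D → ∃ λ d → d ∈ D × Adj v d × c v < c d)
      × (∀ v → v ∈ D → c v ≢ 0)

    IsGammaUC : Subset n → Set
    IsGammaUC D = IsUpColorDom D × (∀ D′ → IsUpColorDom D′ → ∣ D ∣ ≤ ∣ D′ ∣)

    IsLocalMax : Fin n → Set
    IsLocalMax v = ∀ u → Adj v u → c u ≤ c v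

{-# OPTIONS --safe #-}
-- Up-color dominating sets exist as soon as no vertex is isolated: the vertices
-- of nonzero colour form one.  Take an up-color dominating set D that is minimal
-- for the lexicographic order on (|D|, total colour outside D); it is a
-- γ_uc-set.  If a leaf v ∈ D had its only neighbour u of larger colour, then
-- replacing v by u keeps the set up-color dominating (u dominates v, and v
-- dominated no vertex other than u), and the new set is either smaller (u ∈ D)
-- or as large with less colour outside, contradicting minimality.
module Submission where

open import Defs hiding (sym)
open import Algebra.Properties.CommutativeSemigroup using (xy∙z≈xz∙y)
open import Data.Bool using (true; not; T?)
import Data.Bool as Bool
open import Data.Bool.Properties using (T-≡)
open import Data.Fin using (Fin; zero; suc; punchIn)
import Data.Fin as Fin
open import Data.Fin.Properties using (punchInᵢ≢i; all?; any?)
open import Data.Fin.Subset using (Subset; _∈_; _∉_; _⊆_; ∣_∣; ∁; inside; outside)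
open import Data.Fin.Subset.Properties using (_∈?_; anySubset?; x∈p⇒x∉∁p; x∉p⇒x∈∁p)
open import Data.List using ([]; _∷_; filterᵇ; allFin)
open import Data.List.Membership.Propositional using () renaming (_∈_ to _∈ₗ_)
open import Data.List.Membership.Propositional.Properties using (∈-filter⁺; ∈-filter⁻; ∈-allFin)
open import Data.List.Relation.Unary.Any using (here)
open import Data.Maybe.Properties using (just-injective)
open import Data.Nat using (ℕ; suc; _≤_; _<_; _+_; _≟_; _<?_; s≤s; z≤n)
open import Data.Nat.Induction using (<-wellFounded)
open import Data.Nat.Properties
  using (+-comm; +-assoc; +-commutativeSemigroup; +-cancelʳ-≡; +-cancelʳ-<; +-monoʳ-<;
         m<m+n; ≮⇒≥; n≢0⇒n>0; m<n⇒n≢0; module ≤-Reasoning)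
open import Data.Product using (∃; _×_; _,_; proj₁; proj₂)
open import Data.Product.Relation.Binary.Lex.Strict using (×-Lex; ×-wellFounded; ×-decidable)
open import Data.Sum using (_⊎_; inj₁; inj₂)
open import Data.Vec using ([]; _∷_; here; there; _[_]≔_; tabulate)
open import Data.Vec.Properties
  using ([]≔-updates; []≔-minimal; []≔-lookup; []≔-commutes; []=⇒lookup; lookup⇒[]=;
         lookup∘update′; lookup∘tabulate; map-[]≔)
open import Function using (_∘_; _on_; const)
open import Function.Bundles using (Equivalence)
open import Induction.WellFounded using (WellFounded; Acc; acc)
open import Level using (Level; 0ℓ)
open import Relation.Binary using (Rel; Decidable)
import Relation.Binary.Construct.On as On
open import Relation.Binary.PropositionalEquality
  using (_≡_; _≢_; refl; sym; trans; cong; subst; module ≡-Reasoning)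
open import Relation.Nullary using (¬_; Dec; yes; no; does; ¬?; contradiction)
open import Relation.Nullary.Decidable using (_×-dec_; _→-dec_; dec-true; dec-false; decidable-stable)
open import Relation.Unary using (Pred)

private
  variable
    n : ℕ

module _ {a ℓ p : Level} {A : Set a} {_≺_ : Rel A ℓ} (≺-wellFounded : WellFounded _≺_)
         {P : Pred A p} (smaller? : ∀ x → Dec (∃ λ y → P y × y ≺ x)) where

  ∃-minimal : ∀ {x} → P x → ∃ λ m → P m × (∀ y → P y → ¬ y ≺ m)
  ∃-minimal {x} px = descend (≺-wellFounded x) px
    where
    descend : ∀ {x} → Acc _≺_ x → P x → ∃ λ m → P m × (∀ y → P y → ¬ y ≺ m)
    descend {x} (acc rs) px with smaller? x
    ... | yes (y , py , y≺x) = descend (rs y≺x) py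
    ... | no ∄smaller        = x , px , λ y py y≺x → ∄smaller (y , py , y≺x)

weight : (Fin n → ℕ) → Subset n → ℕ
weight w []            = 0
weight w (inside ∷ p)  = w zero + weight (w ∘ suc) p
weight w (outside ∷ p) = weight (w ∘ suc) p

∣p∣≡weight-1 : (p : Subset n) → ∣ p ∣ ≡ weight (const 1) p
∣p∣≡weight-1 []            = refl
∣p∣≡weight-1 (inside ∷ p)  = cong suc (∣p∣≡weight-1 p)
∣p∣≡weight-1 (outside ∷ p) = ∣p∣≡weight-1 p

weight-insert : ∀ w (p : Subset n) {x} → x ∉ p → weight w (p [ x ]≔ inside) ≡ weight w p + w x
weight-insert w (inside ∷ p)  {zero}  x∉p = contradiction here x∉p
weight-insert w (outside ∷ p) {zero}  _   = +-comm (w zero) _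
weight-insert w (inside ∷ p)  {suc x} x∉p =
  trans (cong (w zero +_) (weight-insert (w ∘ suc) p (x∉p ∘ there))) (sym (+-assoc (w zero) _ _))
weight-insert w (outside ∷ p) {suc x} x∉p = weight-insert (w ∘ suc) p (x∉p ∘ there)

weight-remove : ∀ w (p : Subset n) {x} → x ∈ p → weight w p ≡ weight w (p [ x ]≔ outside) + w x
weight-remove w (inside ∷ p)  {zero}  here        = +-comm (w zero) _
weight-remove w (inside ∷ p)  {suc x} (there x∈p) =
  trans (cong (w zero +_) (weight-remove (w ∘ suc) p x∈p)) (sym (+-assoc (w zero) _ _))
weight-remove w (outside ∷ p) {suc x} (there x∈p) = weight-remove (w ∘ suc) p x∈p

∈-[]≔⁻ : ∀ (p : Subset n) {x y b} → x ≢ y → x ∈ p [ y ]≔ b → x ∈ p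
∈-[]≔⁻ p {x} {y} {b} x≢y x∈ = lookup⇒[]= x p (trans (sym (lookup∘update′ x≢y p b)) ([]=⇒lookup x∈))

[]≔outside-⊆ : ∀ (p : Subset n) {x} → p [ x ]≔ outside ⊆ p
[]≔outside-⊆ (_ ∷ p) {zero}  {zero}  ()
[]≔outside-⊆ (_ ∷ p) {zero}  {suc z} (there z∈) = there z∈
[]≔outside-⊆ (_ ∷ p) {suc x} {zero}  here       = here
[]≔outside-⊆ (_ ∷ p) {suc x} {suc z} (there z∈) = there ([]≔outside-⊆ p z∈)

∈⇒[]≔inside-id : ∀ {p : Subset n} {x} → x ∈ p → p [ x ]≔ inside ≡ p
∈⇒[]≔inside-id {p = p} {x} x∈p = trans (cong (p [ x ]≔_) (sym ([]=⇒lookup x∈p))) ([]≔-lookup p x)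

replace : Subset n → Fin n → Fin n → Subset n
replace p x y = p [ x ]≔ outside [ y ]≔ inside

module _ (p : Subset n) {x y : Fin n} where

  y∈replace : y ∈ replace p x y
  y∈replace = []≔-updates (p [ x ]≔ outside) y

  ∈-replace⁺ : ∀ {z} → z ≢ x → z ∈ p → z ∈ replace p x y
  ∈-replace⁺ {z} z≢x z∈p with z Fin.≟ y
  ... | yes refl = y∈replace
  ... | no z≢y   = []≔-minimal (p [ x ]≔ outside) z y z≢y ([]≔-minimal p z x z≢x z∈p)

  ∈-replace⁻ : ∀ {z} → z ∈ replace p x y → z ≡ y ⊎ z ∈ p
  ∈-replace⁻ {z} z∈ with z Fin.≟ y
  ... | yes z≡y = inj₁ z≡y
  ... | no z≢y  = inj₂ ([]≔outside-⊆ p (∈-[]≔⁻ (p [ x ]≔ outside) z≢y z∈))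

  ∁-replace : x ≢ y → ∁ (replace p x y) ≡ replace (∁ p) y x
  ∁-replace x≢y = begin
    ∁ (p [ x ]≔ outside [ y ]≔ inside)  ≡⟨ map-[]≔ not (p [ x ]≔ outside) y ⟩
    ∁ (p [ x ]≔ outside) [ y ]≔ outside ≡⟨ cong (_[ y ]≔ outside) (map-[]≔ not p x) ⟩
    ∁ p [ x ]≔ inside [ y ]≔ outside    ≡⟨ []≔-commutes (∁ p) x y x≢y ⟩
    ∁ p [ y ]≔ outside [ x ]≔ inside    ∎
    where open ≡-Reasoning

  weight-replace : ∀ w → x ∈ p → y ∉ p → weight w (replace p x y) + w x ≡ weight w p + w y
  weight-replace w x∈p y∉p = begin
    weight w (replace p x y) + w x              ≡⟨ cong (_+ w x) (weight-insert w _ (y∉p ∘ []≔outside-⊆ p)) ⟩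
    weight w (p [ x ]≔ outside) + w y + w x     ≡⟨ xy∙z≈xz∙y +-commutativeSemigroup _ (w y) (w x) ⟩
    weight w (p [ x ]≔ outside) + w x + w y     ≡⟨ cong (_+ w y) (sym (weight-remove w p x∈p)) ⟩
    weight w p + w y                            ∎
    where open ≡-Reasoning

  ∣replace∣≡∣p∣ : x ∈ p → y ∉ p → ∣ replace p x y ∣ ≡ ∣ p ∣
  ∣replace∣≡∣p∣ x∈p y∉p = begin
    ∣ replace p x y ∣              ≡⟨ ∣p∣≡weight-1 (replace p x y) ⟩
    weight (const 1) (replace p x y) ≡⟨ +-cancelʳ-≡ 1 _ _ (weight-replace (const 1) x∈p y∉p) ⟩
    weight (const 1) p               ≡⟨ sym (∣p∣≡weight-1 p) ⟩
    ∣ p ∣                          ∎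
    where open ≡-Reasoning

  ∣replace∣<∣p∣ : x ≢ y → x ∈ p → y ∈ p → ∣ replace p x y ∣ < ∣ p ∣
  ∣replace∣<∣p∣ x≢y x∈p y∈p = begin-strict
    ∣ replace p x y ∣                      ≡⟨ cong ∣_∣ (∈⇒[]≔inside-id ([]≔-minimal p y x (x≢y ∘ sym) y∈p)) ⟩
    ∣ p [ x ]≔ outside ∣                   ≡⟨ ∣p∣≡weight-1 (p [ x ]≔ outside) ⟩
    weight (const 1) (p [ x ]≔ outside)     <⟨ m<m+n _ (s≤s z≤n) ⟩
    weight (const 1) (p [ x ]≔ outside) + 1 ≡⟨ sym (weight-remove (const 1) p x∈p) ⟩
    weight (const 1) p                      ≡⟨ sym (∣p∣≡weight-1 p) ⟩
    ∣ p ∣                                  ∎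
    where open ≤-Reasoning

weight-∁-replace : ∀ w (p : Subset n) {x y} → x ∈ p → y ∉ p →
                   weight w (∁ (replace p x y)) + w y ≡ weight w (∁ p) + w x
weight-∁-replace w p {x} {y} x∈p y∉p =
  trans (cong (λ q → weight w q + w y) (∁-replace p x≢y))
        (weight-replace (∁ p) w (x∉p⇒x∈∁p y∉p) (x∈p⇒x∉∁p x∈p))
  where
  x≢y : x ≢ y
  x≢y refl = y∉p x∈p

support : (Fin n → ℕ) → Subset n
support c = tabulate λ i → does (¬? (c i ≟ 0))

module _ {c : Fin n → ℕ} {x : Fin n} where

  ∈-support⁺ : c x ≢ 0 → x ∈ support c
  ∈-support⁺ cx≢0 = lookup⇒[]= x (support c) (trans (lookup∘tabulate _ x) (dec-true (¬? (c x ≟ 0)) cx≢0))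

  ∈-support⁻ : x ∈ support c → c x ≢ 0
  ∈-support⁻ x∈ cx≡0 with () ← trans (sym ([]=⇒lookup x∈))
    (trans (lookup∘tabulate _ x) (dec-false (¬? (c x ≟ 0)) (λ cx≢0 → cx≢0 cx≡0)))

path⇒neighbour : (G : Graph n) {u v : Fin n} → u ≢ v → Path G u v → ∃ (Adj G u)
path⇒neighbour G u≢v record { starts = []    , refl ; ends = ends } = contradiction (just-injective ends) u≢v
path⇒neighbour G _   record { starts = w ∷ _ , refl ; chain = u~w , _ } = w , u~w

connected⇒neighbour : 2 ≤ n → (G : Graph n) → Connected G → ∀ v → ∃ (Adj G v)
connected⇒neighbour (s≤s (s≤s z≤n)) G connected v =
  path⇒neighbour G (punchInᵢ≢i v zero ∘ sym) (connected v (punchIn v zero))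

module _ (G : Graph n) where

  Adj-sym : ∀ {u v} → Adj G u v → Adj G v u
  Adj-sym {u} {v} u~v = trans (Graph.sym G v u) u~v

  Adj⇒≢ : ∀ {u v} → Adj G u v → u ≢ v
  Adj⇒≢ {u} u~u refl with () ← trans (sym u~u) (irrefl G u)

  leaf-neighbour : ∀ {v} → IsLeaf G v → ∃ λ u → Adj G v u × (∀ {x} → Adj G v x → x ≡ u)
  leaf-neighbour {v} leaf with filterᵇ (adj G v) (allFin n) in neighbours | leaf
  ... | u ∷ [] | _ = u , ∈-neighbours⁻ (here refl) , λ v~x → only-u (∈-neighbours⁺ v~x)
    where
    ∈-neighbours⁺ : ∀ {x} → Adj G v x → x ∈ₗ u ∷ []
    ∈-neighbours⁺ {x} v~x = subst (x ∈ₗ_) neighbours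
      (∈-filter⁺ (T? ∘ adj G v) (∈-allFin x) (Equivalence.from T-≡ v~x))
    ∈-neighbours⁻ : ∀ {x} → x ∈ₗ u ∷ [] → Adj G v x
    ∈-neighbours⁻ x∈ = Equivalence.to T-≡
      (proj₂ (∈-filter⁻ (T? ∘ adj G v) {xs = allFin n} (subst (_ ∈ₗ_) (sym neighbours) x∈)))
    only-u : ∀ {x} → x ∈ₗ u ∷ [] → x ≡ u
    only-u (here x≡u) = x≡u

module _ (G : Graph n) (c : Fin n → ℕ) where

  isUpColorDom? : ∀ D → Dec (IsUpColorDom G c D)
  isUpColorDom? D =
    all? (λ v → ¬? (v ∈? D) →-dec any? (λ d → d ∈? D ×-dec adj G v d Bool.≟ true ×-dec c v <? c d))
    ×-dec all? (λ v → v ∈? D →-dec ¬? (c v ≟ 0))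

  support-isUpColorDom : IsColoring G c → (∀ v → ∃ (Adj G v)) → IsUpColorDom G c (support c)
  support-isUpColorDom colouring neighbour = dominated , λ _ → ∈-support⁻ {c = c}
    where
    dominated : ∀ x → x ∉ support c → ∃ λ d → d ∈ support c × Adj G x d × c x < c d
    dominated x x∉ = y , ∈-support⁺ {c = c} cy≢0 , x~y , subst (_< c y) (sym cx≡0) (n≢0⇒n>0 cy≢0)
      where
      cx≡0 : c x ≡ 0
      cx≡0 = decidable-stable (c x ≟ 0) (x∉ ∘ ∈-support⁺ {c = c})
      y : Fin n
      y = proj₁ (neighbour x)
      x~y : Adj G x y
      x~y = proj₂ (neighbour x)
      cy≢0 : c y ≢ 0
      cy≢0 cy≡0 = colouring x y x~y (trans cx≡0 (sym cy≡0))

  rank : Subset n → ℕ × ℕ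
  rank D = ∣ D ∣ , weight c (∁ D)

  _⊏_ : Rel (Subset n) 0ℓ
  _⊏_ = ×-Lex _≡_ _<_ _<_ on rank

  ⊏-wellFounded : WellFounded _⊏_
  ⊏-wellFounded = On.wellFounded rank (×-wellFounded <-wellFounded <-wellFounded)

  _⊏?_ : Decidable _⊏_
  D ⊏? E = ×-decidable _≟_ _<?_ _<?_ (rank D) (rank E)

  module _ {D : Subset n} {v u : Fin n} (D-dom : IsUpColorDom G c D) (v∈D : v ∈ D)
           (v~u : Adj G v u) (only-u : ∀ {x} → Adj G v x → x ≡ u) (cv<cu : c v < c u) where

    replace-isUpColorDom : IsUpColorDom G c (replace D v u)
    replace-isUpColorDom = dominated , nonzero
      where
      dominated : ∀ x → x ∉ replace D v u → ∃ λ d → d ∈ replace D v u × Adj G x d × c x < c d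
      dominated x x∉ with x Fin.≟ v
      ... | yes refl = u , y∈replace D , v~u , cv<cu
      ... | no x≢v with proj₁ D-dom x (x∉ ∘ ∈-replace⁺ D x≢v)
      ...   | d , d∈D , x~d , cx<cd with d Fin.≟ v
      ...     | yes refl = contradiction (subst (_∈ replace D v u) (sym (only-u (Adj-sym G x~d))) (y∈replace D)) x∉
      ...     | no d≢v   = d , ∈-replace⁺ D d≢v d∈D , x~d , cx<cd
      nonzero : ∀ x → x ∈ replace D v u → c x ≢ 0
      nonzero x x∈ with ∈-replace⁻ D x∈
      ... | inj₁ refl = m<n⇒n≢0 cv<cu
      ... | inj₂ x∈D  = proj₂ D-dom x x∈D

    replace⊏ : replace D v u ⊏ D
    replace⊏ with u ∈? D
    ... | yes u∈D = inj₁ (∣replace∣<∣p∣ D (Adj⇒≢ G v~u) v∈D u∈D)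
    ... | no u∉D  = inj₂ (∣replace∣≡∣p∣ D v∈D u∉D , +-cancelʳ-< (c u) _ _ (begin-strict
      weight c (∁ (replace D v u)) + c u ≡⟨ weight-∁-replace c D v∈D u∉D ⟩
      weight c (∁ D) + c v               <⟨ +-monoʳ-< (weight c (∁ D)) cv<cu ⟩
      weight c (∁ D) + c u               ∎))
      where open ≤-Reasoning

  ∃-γuc-set-with-locally-maximal-leaves :
    IsColoring G c → (∀ v → ∃ (Adj G v)) →
    ∃ λ D → IsGammaUC G c D × (∀ v → v ∈ D → IsLeaf G v → IsLocalMax G c v)
  ∃-γuc-set-with-locally-maximal-leaves colouring neighbour
    with ∃-minimal ⊏-wellFounded (λ D → anySubset? (λ E → isUpColorDom? E ×-dec E ⊏? D))
                   (support-isUpColorDom colouring neighbour)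
  ... | D , D-dom , D-minimal = D , (D-dom , minimum-size) , leaves-locally-maximal
    where
    minimum-size : ∀ D′ → IsUpColorDom G c D′ → ∣ D ∣ ≤ ∣ D′ ∣
    minimum-size D′ D′-dom = ≮⇒≥ (D-minimal D′ D′-dom ∘ inj₁)
    leaves-locally-maximal : ∀ v → v ∈ D → IsLeaf G v → IsLocalMax G c v
    leaves-locally-maximal v v∈D leaf x v~x with leaf-neighbour G leaf
    ... | u , v~u , only-u = subst (λ y → c y ≤ c v) (sym (only-u v~x)) (≮⇒≥ λ cv<cu →
      D-minimal _ (replace-isUpColorDom D-dom v∈D v~u only-u cv<cu) (replace⊏ D-dom v∈D v~u only-u cv<cu))

lemma3 : (n : ℕ) → 2 ≤ n → (T : Graph n) → IsTree T →
         (c : Fin n → ℕ) → IsColoring T c →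
         ∃ λ (D : Subset n) → IsGammaUC T c D ×
           (∀ v → v ∈ D → IsLeaf T v → IsLocalMax T c v)
lemma3 n 2≤n T (connected , _) c colouring =
  ∃-γuc-set-with-locally-maximal-leaves T c colouring (connected⇒neighbour 2≤n T connected)
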